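{- Let $\mathcal{A}$ be a path object, and let $\mathcal{B}(p)$ be a path object for each edge $p:x\approx_{\mathcal{A}}y$ (for all $x,y:|\mathcal{A}|$). Assuming dependent function extensionality, the type of unbiased dependent lens structures on $\mathcal{B}$ over $\mathcal{A}$ is a proposition.
   Context: Intensional Martin-Löf type theory with $\Pi,\Sigma$, identity types. A reflexive graph $\mathcal{G}$: type $|\mathcal{G}|$, edge types $x\approx_{\mathcal{G}}y$, $\mathsf{rx}_{\mathcal{G}}(x):x\approx_{\mathcal{G}}x$; a path object if every fan $\sum_yx\approx_{\mathcal{G}}y$ is a proposition. An unbiased dependent lens structure on a family of reflexive graphs $\mathcal{B}(p)$ indexed by edges $p:x\approx_{\mathcal{A}}y$ consists of: $\mathsf{lext}_p:|\mathcal{B}(\mathsf{rx}_{\mathcal{A}}(x))|\to|\mathcal{B}(p)|$ and $\mathsf{rext}_p:|\mathcal{B}(\mathsf{rx}_{\mathcal{A}}(y))|\to|\mathcal{B}(p)|$ for each $p:x\approx_{\mathcal{A}}y$; and for each $x:|\mathcal{A}|$, $u:|\mathcal{B}(\mathsf{rx}_{\mathcal{A}}(x))|$, edges $\mathsf{extRx}_x(u):\mathsf{lext}_{\mathsf{rx}_{\mathcal{A}}(x)}u\approx_{\mathcal{B}(\mathsf{rx}_{\mathcal{A}}(x))}\mathsf{rext}_{\mathsf{rx}_{\mathcal{A}}(x)}u$ and $\mathsf{rextRx}_x(u):u\approx_{\mathcal{B}(\mathsf{rx}_{\mathcal{A}}(x))}\mathsf{rext}_{\mathsf{rx}_{\mathcal{A}}(x)}u$.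 The type of such structures is the iterated $\Sigma$-type of these four components. -}

module Defs where

open import Level using (Level; _⊔_; suc)
open import Data.Product using (Σ; Σ-syntax; _,_)
open import Relation.Binary.PropositionalEquality using (_≡_)

record RGraph (a e : Level) : Set (suc (a ⊔ e)) where
  field
    ∣_∣ : Set a
    _≈_ : ∣_∣ → ∣_∣ → Set e
    rx  : (x : ∣_∣) → x ≈ x

open RGraph public

isProp : {ℓ : Level} → Set ℓ → Set ℓ
isProp X = (u v : X) → u ≡ v

isPathObject : {a e : Level} → RGraph a e → Set (a ⊔ e)
isPathObject G = (x : ∣ G ∣) → isProp (Σ[ y ∈ ∣ G ∣ ] (_≈_ G x y))

UnbiasedDepLens : {a e b f : Level} (A : RGraph a e)
  → ({x y : ∣ A ∣} → _≈_ A x y → RGraph b f) → Set (a ⊔ e ⊔ b ⊔ f)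
UnbiasedDepLens A B =
  Σ[ lext ∈ ({x y : ∣ A ∣} (p : _≈_ A x y) → ∣ B (rx A x) ∣ → ∣ B p ∣) ]
  Σ[ rext ∈ ({x y : ∣ A ∣} (p : _≈_ A x y) → ∣ B (rx A y) ∣ → ∣ B p ∣) ]
  Σ[ extRx ∈ ((x : ∣ A ∣) (u : ∣ B (rx A x) ∣)
       → _≈_ (B (rx A x)) (lext (rx A x) u) (rext (rx A x) u)) ]
  ((x : ∣ A ∣) (u : ∣ B (rx A x) ∣)
       → _≈_ (B (rx A x)) u (rext (rx A x) u))

-- Regroup the edges of A by their source: an edge-indexed section is a family, over each
-- x, of sections over the fan Σ y (x ≈ y).  When A is a path object each fan is a
-- proposition with centre (x , rx x), so a section over it is determined by its value at
-- the centre; this collapses rext together with rextRx to a choice of v with u ≈ v, and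
-- lext together with extRx to a choice of v with v ≈ rext u.  Both choices are unique
-- because fans (and, by the same token, reverse fans) in B are propositions.
module Submission where

open import Defs
open import Level using (Level; _⊔_)
open import Axiom.Extensionality.Propositional using (Extensionality)
open import Data.Product using (Σ; Σ-syntax; _,_; proj₁; proj₂; uncurry)
open import Data.Product.Properties using (Σ-≡,≡→≡; Σ-≡,≡←≡)
open import Relation.Binary.PropositionalEquality
open import Relation.Binary.PropositionalEquality.Properties using (trans-symˡ)

private variable ℓ ℓ' ℓ'' : Level

isProp-retract : {P : Set ℓ} {T : Set ℓ'} → isProp P → (s : T → P) (r : P → T)
  → (∀ t → r (s t) ≡ t) → isProp T
isProp-retract hP s r rs t t' = begin
  t         ≡⟨ sym (rs t) ⟩
  r (s t)   ≡⟨ cong r (hP (s t) (s t')) ⟩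
  r (s t')  ≡⟨ rs t' ⟩
  t'        ∎
  where open ≡-Reasoning

isProp-Σ : {A : Set ℓ} {B : A → Set ℓ'} → isProp A → (∀ a → isProp (B a)) → isProp (Σ A B)
isProp-Σ {B = B} hA hB (a , b) (a' , b') =
  Σ-≡,≡→≡ (hA a a' , hB a' (subst B (hA a a') b) b')

isProp-singleton : {A : Set ℓ} (a : A) → isProp (Σ[ b ∈ A ] a ≡ b)
isProp-singleton a (b , refl) (b' , refl) = refl

isProp-singletonʳ : {A : Set ℓ} (a : A) → isProp (Σ[ b ∈ A ] b ≡ a)
isProp-singletonʳ a (b , refl) (b' , refl) = refl

module _ {a e : Level} (G : RGraph a e) (hG : isPathObject G) where

  ≈⇒≡ : ∀ {z w} → _≈_ G z w → z ≡ w
  ≈⇒≡ {z} {w} p = proj₁ (Σ-≡,≡←≡ (hG z (z , rx G z) (w , p)))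

  ≡⇒≈ : ∀ {z w} → z ≡ w → _≈_ G z w
  ≡⇒≈ {z} α = subst (_≈_ G z) α (rx G z)

  ≡⇒≈∘≈⇒≡ : ∀ {z w} (p : _≈_ G z w) → ≡⇒≈ (≈⇒≡ p) ≡ p
  ≡⇒≈∘≈⇒≡ {z} {w} p = proj₂ (Σ-≡,≡←≡ (hG z (z , rx G z) (w , p)))

  isPathObject⇒isProp-reverseFan : (w : ∣ G ∣) → isProp (Σ[ z ∈ ∣ G ∣ ] _≈_ G z w)
  isPathObject⇒isProp-reverseFan w = isProp-retract (isProp-singletonʳ w)
    (λ (z , p) → z , ≈⇒≡ p)
    (λ (z , α) → z , ≡⇒≈ α)
    (λ (z , p) → cong (z ,_) (≡⇒≈∘≈⇒≡ p))

module _ (ext : ∀ {ℓ₁ ℓ₂ : Level} → Extensionality ℓ₁ ℓ₂) where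

  isProp-Π : {A : Set ℓ} {B : A → Set ℓ'} → (∀ x → isProp (B x)) → isProp ((x : A) → B x)
  isProp-Π h f g = ext (λ x → h x (f x) (g x))

  isProp-Σ-Π : {A : Set ℓ} {B : A → Set ℓ'} {C : (x : A) → B x → Set ℓ''}
    → (∀ x → isProp (Σ (B x) (C x)))
    → isProp (Σ[ f ∈ ((x : A) → B x) ] ((x : A) → C x (f x)))
  isProp-Σ-Π h = isProp-retract (isProp-Π h)
    (λ (f , c) x → f x , c x)
    (λ k → (λ x → proj₁ (k x)) , (λ x → proj₂ (k x)))
    (λ _ → refl)

  homotopy-ind : {A : Set ℓ} {B : A → Set ℓ'} (f : (x : A) → B x)
    (Q : (g : (x : A) → B x) → (∀ x → f x ≡ g x) → Set ℓ'')
    → Q f (λ _ → refl) → ∀ g h → Q g h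
  homotopy-ind f Q q g h =
    subst (uncurry Q) (isProp-Σ-Π (λ x → isProp-singleton (f x)) (f , λ _ → refl) (g , h)) q

  -- By homotopy induction it suffices to produce a homotopy f ≗ g whose value at c
  -- transports d to d'; transporting the given path f c ≡ g c along c ≡ w yields one.
  isProp-Σ-Π-at-centre : {P : Set ℓ} → isProp P → (c : P) {E : P → Set ℓ'}
    (D : E c → Set ℓ'') → isProp (Σ (E c) D)
    → isProp (Σ[ f ∈ ((w : P) → E w) ] D (f c))
  isProp-Σ-Π-at-centre {P = P} hP c {E} D hD (f , d) (g , d') =
    ≡-if-agree-at-centre g f≗g d' (trans (cong (λ π → subst D π d) f≗g-at-centre) dβ)
    where
    β : f c ≡ g c
    β = proj₁ (Σ-≡,≡←≡ (hD (f c , d) (g c , d')))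

    dβ : subst D β d ≡ d'
    dβ = proj₂ (Σ-≡,≡←≡ (hD (f c , d) (g c , d')))

    -- normalised so that κ c is provably refl
    κ : ∀ w → c ≡ w
    κ w = trans (sym (hP c c)) (hP c w)

    f≗g : ∀ w → f w ≡ g w
    f≗g w = subst (λ w → f w ≡ g w) (κ w) β

    f≗g-at-centre : f≗g c ≡ β
    f≗g-at-centre = cong (λ π → subst (λ w → f w ≡ g w) π β) (trans-symˡ (hP c c))

    ≡-if-agree-at-centre : ∀ g (h : ∀ w → f w ≡ g w) d' → subst D (h c) d ≡ d'
      → _≡_ {A = Σ[ f ∈ ((w : P) → E w) ] D (f c)} (f , d) (g , d')
    ≡-if-agree-at-centre = homotopy-ind f _ (λ _ → cong (f ,_))

  isProp-edge-section : {a e b d : Level} (A : RGraph a e) → isPathObject A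
    → (E : {x y : ∣ A ∣} → _≈_ A x y → Set b) (D : (x : ∣ A ∣) → E (rx A x) → Set d)
    → (∀ x → isProp (Σ (E (rx A x)) (D x)))
    → isProp (Σ[ s ∈ ({x y : ∣ A ∣} (p : _≈_ A x y) → E p) ] ((x : ∣ A ∣) → D x (s (rx A x))))
  isProp-edge-section A hA E D hD = isProp-retract
    (isProp-Π (λ x → isProp-Σ-Π-at-centre (hA x) (x , rx A x) (D x) (hD x)))
    (λ (s , t) x → (λ (y , p) → s p) , t x)
    (λ k → (λ {x} {y} p → proj₁ (k x) (y , p)) , (λ x → proj₂ (k x)))
    (λ _ → refl)

mainTheorem10 : {a e b f : Level}
    → (∀ {ℓ₁ ℓ₂ : Level} → Extensionality ℓ₁ ℓ₂)
    → (A : RGraph a e) → isPathObject A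
    → (B : {x y : ∣ A ∣} → _≈_ A x y → RGraph b f)
    → ({x y : ∣ A ∣} (p : _≈_ A x y) → isPathObject (B p))
    → isProp (UnbiasedDepLens A B)
mainTheorem10 {a} {e} {b} {f} ext A hA B hB =
  isProp-retract (isProp-Σ isProp-RextStructure (λ (rext , _) → isProp-LextStructure rext))
    (λ (lext , rext , extRx , rextRx) →
      ((λ {x} {y} → rext {x} {y}) , rextRx) , ((λ {x} {y} → lext {x} {y}) , extRx))
    (λ ((rext , rextRx) , (lext , extRx)) →
      (λ {x} {y} → lext {x} {y}) , (λ {x} {y} → rext {x} {y}) , extRx , rextRx)
    (λ _ → refl)
  where
  Rext Lext : Set (a ⊔ e ⊔ b)
  Rext = {x y : ∣ A ∣} (p : _≈_ A x y) → ∣ B (rx A y) ∣ → ∣ B p ∣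
  Lext = {x y : ∣ A ∣} (p : _≈_ A x y) → ∣ B (rx A x) ∣ → ∣ B p ∣

  RextStructure : Set (a ⊔ e ⊔ b ⊔ f)
  RextStructure = Σ[ rext ∈ Rext ] (∀ x u → _≈_ (B (rx A x)) u (rext (rx A x) u))

  LextStructure : Rext → Set (a ⊔ e ⊔ b ⊔ f)
  LextStructure rext =
    Σ[ lext ∈ Lext ] (∀ x u → _≈_ (B (rx A x)) (lext (rx A x) u) (rext (rx A x) u))

  isProp-RextStructure : isProp RextStructure
  isProp-RextStructure = isProp-edge-section ext A hA
    (λ {x} {y} p → ∣ B (rx A y) ∣ → ∣ B p ∣)
    (λ x r → ∀ u → _≈_ (B (rx A x)) u (r u))
    (λ x → isProp-Σ-Π ext (hB (rx A x)))

  isProp-LextStructure : (rext : Rext) → isProp (LextStructure rext)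
  isProp-LextStructure rext = isProp-edge-section ext A hA
    (λ {x} {y} p → ∣ B (rx A x) ∣ → ∣ B p ∣)
    (λ x l → ∀ u → _≈_ (B (rx A x)) (l u) (rext (rx A x) u))
    (λ x → isProp-Σ-Π ext (λ u →
      isPathObject⇒isProp-reverseFan (B (rx A x)) (hB (rx A x)) (rext (rx A x) u)))
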